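{- If $\sigma$ is a subpattern of $\pi$, then $w(\sigma)\le w(\pi)$.
   Context: A permutation is a pair $\pi=(S,P)$, $S$ a finite set of positive integers, $P:S\to\mathbb{N}^2$ injective with $P(S)$ in general position. For $\alpha\in\{1,2\}$, $p<^{\pi}_{\alpha}p'$ means the $\alpha$-th coordinate of $P(p)$ is smaller than that of $P(p')$. An embedding of $\sigma$ into $\pi$ is $\phi:S(\sigma)\to S(\pi)$ with $p<^{\sigma}_{\alpha}p'\iff\phi(p)<^{\pi}_{\alpha}\phi(p')$; $\sigma$ is a subpattern of $\pi$ if one exists. Intervals are discrete $[a,b]=\{a,\dots,b\}$; a rectangle is $R=I\times J$, $I_1(R)=I$, $I_2(R)=J$. A rectangle family is $\mathcal{R}=(S,R)$ with $S\subseteq\mathbb{N}$ finite and $R(i)$ a rectangle for each $i\in S$; $\pi$ is the family $R(i)=\{P(i)\}$. For $i,j\in S$, $k\notin S$, $\mathcal{R}[i,j\to k]$ replaces $R(i),R(j)$ by the smallest rectangle containing both, indexed $k$. A decomposition of $\pi$ is $(\mathcal{R}_0,\dots,\mathcal{R}_s)$ with $\mathcal{R}_0=\pi$, integers $\max S<k_1<\dots<k_s$, $\mathcal{R}_p=\mathcal{R}_{p-1}[i,j\to k_p]$ for some $i,j\in S(\mathcal{R}_{p-1})$, and $|\mathcal{R}_s|=1$. Rectangles $R,R'$ $\alpha$-view each other if $I_\alpha(R)\cap I_\alpha(R')\ne\emptyset$; $\mathrm{view}_\alpha(\mathcal{R},i)$ is the set of $j\in S\setminus\{i\}$ with $R(i),R(j)$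 $\alpha$-viewing each other; $\mathrm{view}(\mathcal{R},i)=\max_{\alpha}|\mathrm{view}_\alpha(\mathcal{R},i)|$. $\mathcal{R}$ is $d$-wide if $\mathrm{view}(\mathcal{R},i)<d$ for all $i$; a decomposition is $d$-wide if all its families are. The width $w(\pi)$ is the minimum $d$ such that $\pi$ has a $d$-wide decomposition. -}

module Defs where

open import Data.Nat using (ℕ; _<_; _≤_; _≟_; _≤?_; _⊔_; _⊓_)
open import Data.Product using (_×_; _,_; proj₁; proj₂)
open import Data.List using (List; []; _∷_; length; filter; foldr)
open import Data.List.Membership.Propositional using (_∈_)
open import Data.List.Relation.Unary.All using (All)
open import Data.List.Relation.Unary.Unique.Propositional using (Unique)
open import Relation.Binary.PropositionalEquality using (_≡_; _≢_)
open import Relation.Nullary using (¬_; Dec; yes; no)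
open import Relation.Nullary.Decidable using (_×-dec_; ¬?)

-- A permutation π = (S, P): S a finite set of positive integers (a duplicate-free
-- list), P : S → ℕ² (given as a total function, only its values on S matter),
-- injective with image in general position (distinct points differ in both coordinates).
record Perm : Set where
  field
    S      : List ℕ
    P      : ℕ → ℕ × ℕ
    uniq   : Unique S
    pos    : All (λ p → 0 < p) S
    inj    : ∀ {p q} → p ∈ S → q ∈ S → P p ≡ P q → p ≡ q
    genpos : ∀ {p q} → p ∈ S → q ∈ S → p ≢ q →
             (proj₁ (P p) ≢ proj₁ (P q)) × (proj₂ (P p) ≢ proj₂ (P q))
open Perm public

_<₁[_]_ : ℕ → Perm → ℕ → Set
p <₁[ π ] p' = proj₁ (P π p) < proj₁ (P π p')

_<₂[_]_ : ℕ → Perm → ℕ → Set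
p <₂[ π ] p' = proj₂ (P π p) < proj₂ (P π p')

IsEmbedding : Perm → Perm → (ℕ → ℕ) → Set
IsEmbedding σ π φ =
  (∀ {p} → p ∈ S σ → φ p ∈ S π) ×
  (∀ {p p'} → p ∈ S σ → p' ∈ S σ →
     ((p <₁[ σ ] p' → φ p <₁[ π ] φ p') × (φ p <₁[ π ] φ p' → p <₁[ σ ] p')) ×
     ((p <₂[ σ ] p' → φ p <₂[ π ] φ p') × (φ p <₂[ π ] φ p' → p <₂[ σ ] p')))

data Subpattern (σ π : Perm) : Set where
  embeds : (φ : ℕ → ℕ) → IsEmbedding σ π φ → Subpattern σ π

-- Discrete interval [a,b] = {a,…,b}, stored as (a , b); rectangle I × J.
Interval : Set
Interval = ℕ × ℕ

record Rect : Set where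
  constructor _⊠_
  field
    I₁ : Interval
    I₂ : Interval
open Rect public

record Family : Set where
  constructor fam
  field
    FS : List ℕ
    FR : ℕ → Rect
open Family public

toFamily : Perm → Family
toFamily π = fam (S π) (λ i → (proj₁ (P π i) , proj₁ (P π i)) ⊠ (proj₂ (P π i) , proj₂ (P π i)))

ihull : Interval → Interval → Interval
ihull (a , b) (a' , b') = (a ⊓ a') , (b ⊔ b')

rhull : Rect → Rect → Rect
rhull (I ⊠ J) (I' ⊠ J') = ihull I I' ⊠ ihull J J'

mergeR : (ℕ → Rect) → ℕ → ℕ → ℕ → ℕ → Rect
mergeR R i j k x with x ≟ k
... | yes _ = rhull (R i) (R j)
... | no  _ = R x

merge : Family → ℕ → ℕ → ℕ → Family
merge (fam s R) i j k =
  fam (k ∷ filter (λ x → ¬? (x ≟ i) ×-dec ¬? (x ≟ j)) s) (mergeR R i j k)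

intersects? : (I I' : Interval) → Dec ((proj₁ I ≤ proj₂ I') × (proj₁ I' ≤ proj₂ I))
intersects? (a , b) (a' , b') = (a ≤? b') ×-dec (a' ≤? b)

view₁ view₂ : Family → ℕ → ℕ
view₁ (fam s R) i = length (filter (λ j → ¬? (j ≟ i) ×-dec intersects? (I₁ (R i)) (I₁ (R j))) s)
view₂ (fam s R) i = length (filter (λ j → ¬? (j ≟ i) ×-dec intersects? (I₂ (R i)) (I₂ (R j))) s)

view : Family → ℕ → ℕ
view F i = view₁ F i ⊔ view₂ F i

Wide : ℕ → Family → Set
Wide d F = ∀ {i} → i ∈ FS F → view F i < d

maxS : List ℕ → ℕ
maxS = foldr _⊔_ 0

-- d-wide decompositions starting from family F, where the next new index
-- must exceed m (m = max S(π) initially, then the previously used k).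
data WideDecompFrom (d : ℕ) : Family → ℕ → Set where
  done : ∀ {F m} → Wide d F → length (FS F) ≡ 1 → WideDecompFrom d F m
  step : ∀ {F m} (i j k : ℕ) → i ∈ FS F → j ∈ FS F → i ≢ j → m < k →
         Wide d F → WideDecompFrom d (merge F i j k) k → WideDecompFrom d F m

HasWideDecomp : ℕ → Perm → Set
HasWideDecomp d π = WideDecompFrom d (toFamily π) (maxS (S π))

IsWidth : Perm → ℕ → Set
IsWidth π w = HasWideDecomp w π × (∀ d → HasWideDecomp d π → w ≤ d)

-- Fix an embedding φ of σ into π and a d-wide decomposition of π.  We replay that
-- decomposition on σ.  Throughout, every rectangle of the current σ-family G is
-- assigned, injectively, a rectangle of the current π-family F that *shadows* it:
-- along each axis, the lower end of the σ-rectangle lies to the right of some point p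
-- of σ whose image φ(p) lies to the right of the lower end of the π-rectangle, and
-- symmetrically for the upper ends.  Since φ is monotone along both axes, rectangles
-- that view each other in σ are assigned rectangles that view each other in π, so by
-- injectivity every view count in G is at most the corresponding one in F.
-- When π merges the rectangles i and j, σ merges their preimages if both exist
-- (shadowing is preserved by taking hulls); otherwise σ does nothing and the
-- assignment is redirected to the merged rectangle, which contains the old one.
-- When π's decomposition ends with one rectangle, injectivity leaves one in σ.
module Submission where

open import Defs
open import Data.Nat using (ℕ; _≤_; _<_; _≟_; _⊔_; _⊓_; _+_; z≤n; s≤s)
open import Data.Nat.Properties
open import Data.Product using (Σ-syntax; _×_; _,_; proj₁; proj₂)
open import Data.Sum using (_⊎_; inj₁; inj₂)
open import Data.Empty using (⊥-elim)
open import Data.List using (List; []; _∷_; length; filter)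
open import Data.List.Membership.Propositional using (_∈_; find; lose)
open import Data.List.Membership.Propositional.Properties using (∈-filter⁺; ∈-filter⁻)
open import Data.List.Relation.Unary.Any using (here; there; any?)
import Data.List.Relation.Unary.Any as Any
import Data.List.Relation.Unary.All as All
open import Data.List.Relation.Unary.AllPairs using (_∷_)
open import Data.List.Relation.Unary.Unique.Propositional using (Unique)
import Data.List.Relation.Unary.Unique.Propositional.Properties as Unique
open import Data.List.Properties using (filter-notAll)
open import Relation.Binary.Definitions using (DecidableEquality)
open import Relation.Binary.PropositionalEquality using (_≡_; _≢_; refl; sym; trans; cong; subst)
open import Relation.Nullary using (¬_; Dec; yes; no)
open import Relation.Nullary.Decidable using (_×-dec_; ¬?)
open import Function using (_∘_)

-- Pigeonhole for lists: an injection from a duplicate-free list into a list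
-- cannot enlarge it.  Each image point is removed from the target in turn.
length-≤-injection : {A B : Set} (_≟B_ : DecidableEquality B) (f : A → B)
  {xs : List A} {ys : List B} → Unique xs →
  (∀ {x y} → x ∈ xs → y ∈ xs → f x ≡ f y → x ≡ y) →
  (∀ {x} → x ∈ xs → f x ∈ ys) → length xs ≤ length ys
length-≤-injection _≟B_ f {[]} _ _ _ = z≤n
length-≤-injection {B = B} _≟B_ f {x ∷ xs} {ys} (x∉xs ∷ xs-unique) f-inj f-into =
  ≤-trans (s≤s rest≤) (filter-notAll other? ys fx-not-other)
  where
  other? : (y : B) → Dec (y ≢ f x)
  other? y = ¬? (y ≟B f x)
  fx-not-other : Any.Any (λ y → ¬ (y ≢ f x)) ys
  fx-not-other = Any.map (λ fx≡y y≢fx → y≢fx (sym fx≡y)) (f-into (here refl))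
  rest≤ : length xs ≤ length (filter other? ys)
  rest≤ = length-≤-injection _≟B_ f xs-unique (λ a b → f-inj (there a) (there b))
    (λ y∈ → ∈-filter⁺ other? (f-into (there y∈))
      (λ fy≡fx → All.lookup x∉xs y∈ (sym (f-inj (there y∈) (here refl) fy≡fx))))

∈⇒≤maxS : ∀ {x xs} → x ∈ xs → x ≤ maxS xs
∈⇒≤maxS {xs = y ∷ ys} (here refl) = m≤m⊔n y (maxS ys)
∈⇒≤maxS {xs = y ∷ ys} (there x∈) = ≤-trans (∈⇒≤maxS x∈) (m≤n⊔m y (maxS ys))

lower-start : ∀ {d F m₀ m} → m₀ ≤ m → WideDecompFrom d F m → WideDecompFrom d F m₀
lower-start _ (done wide single) = done wide single
lower-start m₀≤m (step i j k i∈ j∈ i≢j m<k wide rest) =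
  step i j k i∈ j∈ i≢j (≤-<-trans m₀≤m m<k) wide rest

decomposable⇒nonempty : ∀ {d F m} → WideDecompFrom d F m → 1 ≤ length (FS F)
decomposable⇒nonempty (done _ single) = subst (1 ≤_) (sym single) ≤-refl
decomposable⇒nonempty (step _ _ _ (here _) _ _ _ _ _) = s≤s z≤n
decomposable⇒nonempty (step _ _ _ (there _) _ _ _ _ _) = s≤s z≤n

data Axis : Set where
  horizontal vertical : Axis

coord : Axis → ℕ × ℕ → ℕ
coord horizontal = proj₁
coord vertical   = proj₂

side : Axis → Rect → Interval
side horizontal = I₁
side vertical   = I₂

lo hi : Interval → ℕ
lo = proj₁
hi = proj₂

-- j ∈ view_α(F, i).  Counting these (viewAlong) gives, definitionally, view₁ and
-- view₂ for the two axes.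
Views : Axis → Family → ℕ → ℕ → Set
Views α F i j = j ≢ i × (lo (side α (FR F i)) ≤ hi (side α (FR F j)) ×
                         lo (side α (FR F j)) ≤ hi (side α (FR F i)))

views? : ∀ α F i j → Dec (Views α F i j)
views? α F i j = ¬? (j ≟ i) ×-dec intersects? (side α (FR F i)) (side α (FR F j))

viewAlong : Axis → Family → ℕ → ℕ
viewAlong α F i = length (filter (views? α F i) (FS F))

_⊑_ : Interval → Interval → Set
I ⊑ J = lo J ≤ lo I × hi I ≤ hi J

_⊑ᴿ_ : Rect → Rect → Set
Q ⊑ᴿ R = ∀ α → side α Q ⊑ side α R

⊑ᴿ-refl : ∀ {Q} → Q ⊑ᴿ Q
⊑ᴿ-refl α = ≤-refl , ≤-refl

⊑ᴿ-hullˡ : ∀ Q R → Q ⊑ᴿ rhull Q R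
⊑ᴿ-hullˡ Q R horizontal = m⊓n≤m _ _ , m≤m⊔n _ _
⊑ᴿ-hullˡ Q R vertical   = m⊓n≤m _ _ , m≤m⊔n _ _

⊑ᴿ-hullʳ : ∀ Q R → R ⊑ᴿ rhull Q R
⊑ᴿ-hullʳ Q R horizontal = m⊓n≤n _ _ , m≤n⊔m _ _
⊑ᴿ-hullʳ Q R vertical   = m⊓n≤n _ _ , m≤n⊔m _ _

-- Facts about one merge step F ↦ merge F i j k.  An index x survives the merge
-- when it is none of the two merged indices (the filter condition of merge).
Misses : ℕ → ℕ → ℕ → Set
Misses i j x = x ≢ i × x ≢ j

misses? : ∀ i j x → Dec (Misses i j x)
misses? i j x = ¬? (x ≟ i) ×-dec ¬? (x ≟ j)

¬misses⇒hits : ∀ {i j x} → ¬ Misses i j x → x ≡ i ⊎ x ≡ j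
¬misses⇒hits {i} {j} {x} ¬m with x ≟ i
... | yes x≡i = inj₁ x≡i
... | no x≢i with x ≟ j
...   | yes x≡j = inj₂ x≡j
...   | no x≢j = ⊥-elim (¬m (x≢i , x≢j))

merge-new : ∀ F i j k → FR (merge F i j k) k ≡ rhull (FR F i) (FR F j)
merge-new F i j k with k ≟ k
... | yes _ = refl
... | no k≢k = ⊥-elim (k≢k refl)

merge-old : ∀ F i j {k x} → x ≢ k → FR (merge F i j k) x ≡ FR F x
merge-old F i j {k} {x} x≢k with x ≟ k
... | yes x≡k = ⊥-elim (x≢k x≡k)
... | no _ = refl

merge-unique : ∀ F i j {k} → Unique (FS F) → (∀ {x} → x ∈ FS F → x < k) →
               Unique (FS (merge F i j k))
merge-unique F i j u below =
  All.tabulate (λ x∈ k≡x → <-irrefl (sym k≡x) (below (proj₁ (∈-filter⁻ (misses? i j) x∈))))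
  ∷ Unique.filter⁺ (misses? i j) u

merge-bounded : ∀ F i j {b k} → (∀ {x} → x ∈ FS F → x ≤ b) → b < k →
                ∀ {x} → x ∈ FS (merge F i j k) → x ≤ k
merge-bounded F i j bounded b<k (here refl) = ≤-refl
merge-bounded F i j bounded b<k (there x∈) =
  <⇒≤ (≤-<-trans (bounded (proj₁ (∈-filter⁻ (misses? i j) x∈))) b<k)

redirect : ℕ → ℕ → ℕ → ℕ → ℕ
redirect i j k x with misses? i j x
... | yes _ = x
... | no _  = k

redirect-∈ : ∀ F i j k {x} → x ∈ FS F → redirect i j k x ∈ FS (merge F i j k)
redirect-∈ F i j k {x} x∈ with misses? i j x
... | yes m = there (∈-filter⁺ (misses? i j) x∈ m)
... | no _  = here refl

redirect-⊑ᴿ : ∀ F i j k {x} → x ≢ k → FR F x ⊑ᴿ FR (merge F i j k) (redirect i j k x)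
redirect-⊑ᴿ F i j k {x} x≢k with misses? i j x
... | yes _ = subst (FR F x ⊑ᴿ_) (sym (merge-old F i j x≢k)) ⊑ᴿ-refl
... | no ¬m = subst (FR F x ⊑ᴿ_) (sym (merge-new F i j k)) (in-hull (¬misses⇒hits ¬m))
  where
  in-hull : x ≡ i ⊎ x ≡ j → FR F x ⊑ᴿ rhull (FR F i) (FR F j)
  in-hull (inj₁ refl) = ⊑ᴿ-hullˡ (FR F i) (FR F j)
  in-hull (inj₂ refl) = ⊑ᴿ-hullʳ (FR F i) (FR F j)

redirect-collision : ∀ {i j k x y} → x ≢ y → x ≢ k → y ≢ k →
  redirect i j k x ≡ redirect i j k y → ¬ Misses i j x × ¬ Misses i j y
redirect-collision {i} {j} {k} {x} {y} x≢y x≢k y≢k eq with misses? i j x | misses? i j y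
... | yes _  | yes _  = ⊥-elim (x≢y eq)
... | yes _  | no _   = ⊥-elim (x≢k eq)
... | no _   | yes _  = ⊥-elim (y≢k (sym eq))
... | no ¬mx | no ¬my = ¬mx , ¬my

assign : ℕ → ℕ → (ℕ → ℕ) → ℕ → ℕ
assign k' k f w with w ≟ k'
... | yes _ = k
... | no _  = f w

assign-new : ∀ k' k f → assign k' k f k' ≡ k
assign-new k' k f with k' ≟ k'
... | yes _ = refl
... | no k'≢k' = ⊥-elim (k'≢k' refl)

assign-old : ∀ {k' k f w} → w ≢ k' → assign k' k f w ≡ f w
assign-old {k'} {w = w} w≢k' with w ≟ k'
... | yes w≡k' = ⊥-elim (w≢k' w≡k')
... | no _ = refl

assign-injective : ∀ {k' k f ts} → (∀ {w} → w ∈ ts → w ≢ k') → (∀ {w} → w ∈ ts → f w ≢ k) →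
  (∀ {w w'} → w ∈ ts → w' ∈ ts → f w ≡ f w' → w ≡ w') →
  ∀ {w w'} → w ∈ k' ∷ ts → w' ∈ k' ∷ ts → assign k' k f w ≡ assign k' k f w' → w ≡ w'
assign-injective new old f-inj (here refl) (here refl) eq = refl
assign-injective {k'} {k} {f} new old f-inj (here refl) (there w'∈) eq
  rewrite assign-new k' k f | assign-old {k'} {k} {f} (new w'∈) = ⊥-elim (old w'∈ (sym eq))
assign-injective {k'} {k} {f} new old f-inj (there w∈) (here refl) eq
  rewrite assign-new k' k f | assign-old {k'} {k} {f} (new w∈) = ⊥-elim (old w∈ eq)
assign-injective {k'} {k} {f} new old f-inj (there w∈) (there w'∈) eq
  rewrite assign-old {k'} {k} {f} (new w∈) | assign-old {k'} {k} {f} (new w'∈) = f-inj w∈ w'∈ eq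

module Replay (σ π : Perm) (φ : ℕ → ℕ) (emb : IsEmbedding σ π φ) where

  φ-< : ∀ α {p q} → p ∈ S σ → q ∈ S σ →
        coord α (P σ p) < coord α (P σ q) → coord α (P π (φ p)) < coord α (P π (φ q))
  φ-< horizontal p∈ q∈ = proj₁ (proj₁ (proj₂ emb p∈ q∈))
  φ-< vertical   p∈ q∈ = proj₁ (proj₂ (proj₂ emb p∈ q∈))

  φ-strict : ∀ α {p q} → p ∈ S σ → q ∈ S σ → p ≢ q →
             coord α (P σ p) ≤ coord α (P σ q) → coord α (P π (φ p)) < coord α (P π (φ q))
  φ-strict α p∈ q∈ p≢q le = φ-< α p∈ q∈ (≤∧≢⇒< le (general-position α p∈ q∈ p≢q))
    where
    general-position : ∀ α {p q} → p ∈ S σ → q ∈ S σ → p ≢ q →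
                       coord α (P σ p) ≢ coord α (P σ q)
    general-position horizontal p∈ q∈ p≢q = proj₁ (genpos σ p∈ q∈ p≢q)
    general-position vertical   p∈ q∈ p≢q = proj₂ (genpos σ p∈ q∈ p≢q)

  φ-monotone : ∀ α {p q} → p ∈ S σ → q ∈ S σ →
               coord α (P σ p) ≤ coord α (P σ q) → coord α (P π (φ p)) ≤ coord α (P π (φ q))
  φ-monotone α {p} {q} p∈ q∈ le with p ≟ q
  ... | yes refl = ≤-refl
  ... | no p≢q = <⇒≤ (φ-strict α p∈ q∈ p≢q le)

  φ-injective : ∀ {p q} → p ∈ S σ → q ∈ S σ → φ p ≡ φ q → p ≡ q
  φ-injective {p} {q} p∈ q∈ φp≡φq with p ≟ q
  ... | yes p≡q = p≡q
  ... | no p≢q with ≤-total (proj₁ (P σ p)) (proj₁ (P σ q))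
  ...   | inj₁ le = ⊥-elim (<-irrefl (cong (λ r → proj₁ (P π r)) φp≡φq)
                                     (φ-strict horizontal p∈ q∈ p≢q le))
  ...   | inj₂ ge = ⊥-elim (<-irrefl (cong (λ r → proj₁ (P π r)) (sym φp≡φq))
                                     (φ-strict horizontal q∈ p∈ (λ q≡p → p≢q (sym q≡p)) ge))

  LowerAnchor UpperAnchor Shadows : Axis → Interval → Interval → Set
  LowerAnchor α I J = Σ[ p ∈ ℕ ] p ∈ S σ × coord α (P σ p) ≤ lo I × lo J ≤ coord α (P π (φ p))
  UpperAnchor α I J = Σ[ p ∈ ℕ ] p ∈ S σ × hi I ≤ coord α (P σ p) × coord α (P π (φ p)) ≤ hi J
  Shadows α I J = LowerAnchor α I J × UpperAnchor α I J

  _◁_ : Rect → Rect → Set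
  Q ◁ R = ∀ α → Shadows α (side α Q) (side α R)

  point-◁ : ∀ {p} → p ∈ S σ → FR (toFamily σ) p ◁ FR (toFamily π) (φ p)
  point-◁ p∈ horizontal = (_ , p∈ , ≤-refl , ≤-refl) , (_ , p∈ , ≤-refl , ≤-refl)
  point-◁ p∈ vertical   = (_ , p∈ , ≤-refl , ≤-refl) , (_ , p∈ , ≤-refl , ≤-refl)

  shadows-meet : ∀ α {I I' J J'} → Shadows α I J → Shadows α I' J' →
                 lo I ≤ hi I' → lo J ≤ hi J'
  shadows-meet α {J = J} {J' = J'} ((p , p∈ , σp≤ , ≤φp) , _) (_ , (q , q∈ , ≤σq , φq≤)) lo≤hi =
    begin
      lo J                ≤⟨ ≤φp ⟩
      coord α (P π (φ p)) ≤⟨ φ-monotone α p∈ q∈ (≤-trans σp≤ (≤-trans lo≤hi ≤σq)) ⟩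
      coord α (P π (φ q)) ≤⟨ φq≤ ⟩
      hi J'
    ∎
    where open ≤-Reasoning

  -- Shadowing is compatible with hulls: the anchor of the hull's end is the anchor
  -- of whichever interval realises that end.
  shadows-hull : ∀ α {I I' J J'} → Shadows α I J → Shadows α I' J' →
                 Shadows α (ihull I I') (ihull J J')
  shadows-hull α {I} {I'} {J} {J'} (lowI , upI) (lowI' , upI') =
    lower (⊓-sel (lo I) (lo I')) , upper (⊔-sel (hi I) (hi I'))
    where
    lower : lo I ⊓ lo I' ≡ lo I ⊎ lo I ⊓ lo I' ≡ lo I' → LowerAnchor α (ihull I I') (ihull J J')
    lower (inj₁ eq) = let p , p∈ , a , b = lowI in
      p , p∈ , subst (_ ≤_) (sym eq) a , ≤-trans (m⊓n≤m _ _) b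
    lower (inj₂ eq) = let p , p∈ , a , b = lowI' in
      p , p∈ , subst (_ ≤_) (sym eq) a , ≤-trans (m⊓n≤n _ _) b
    upper : hi I ⊔ hi I' ≡ hi I ⊎ hi I ⊔ hi I' ≡ hi I' → UpperAnchor α (ihull I I') (ihull J J')
    upper (inj₁ eq) = let p , p∈ , a , b = upI in
      p , p∈ , subst (_≤ _) (sym eq) a , ≤-trans b (m≤m⊔n _ _)
    upper (inj₂ eq) = let p , p∈ , a , b = upI' in
      p , p∈ , subst (_≤ _) (sym eq) a , ≤-trans b (m≤n⊔m _ _)

  ◁-hull : ∀ {Q Q' R R'} → Q ◁ R → Q' ◁ R' → rhull Q Q' ◁ rhull R R'
  ◁-hull Q◁R Q'◁R' horizontal = shadows-hull horizontal (Q◁R horizontal) (Q'◁R' horizontal)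
  ◁-hull Q◁R Q'◁R' vertical   = shadows-hull vertical (Q◁R vertical) (Q'◁R' vertical)

  ◁-widen : ∀ {Q R R'} → Q ◁ R → R ⊑ᴿ R' → Q ◁ R'
  ◁-widen Q◁R R⊑R' α with Q◁R α | R⊑R' α
  ... | (p , p∈ , a , b) , (q , q∈ , c , e) | lo≥ , hi≤ =
    (p , p∈ , a , ≤-trans lo≥ b) , (q , q∈ , c , ≤-trans e hi≤)

  -- Fresh σ-indices are offset by max S(σ) from the fresh π-indices, so that they
  -- never clash with the points of σ.
  offset : ℕ
  offset = maxS (S σ)

  -- The replay invariant between the current σ-family G and π-family F: f assigns to
  -- each σ-rectangle, injectively, a shadowing π-rectangle; indices of F are at most
  -- m (the last fresh π-index) and those of G at most m + offset.
  record Shadowing (G F : Family) (m : ℕ) (f : ℕ → ℕ) : Set where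
    field
      G-unique    : Unique (FS G)
      G-nonempty  : 1 ≤ length (FS G)
      G-bounded   : ∀ {u} → u ∈ FS G → u ≤ m + offset
      F-bounded   : ∀ {x} → x ∈ FS F → x ≤ m
      f-into      : ∀ {u} → u ∈ FS G → f u ∈ FS F
      f-injective : ∀ {u v} → u ∈ FS G → v ∈ FS G → f u ≡ f v → u ≡ v
      f-shadows   : ∀ {u} → u ∈ FS G → FR G u ◁ FR F (f u)
  open Shadowing

  initial : 1 ≤ length (S σ) → Shadowing (toFamily σ) (toFamily π) (maxS (S π)) φ
  initial nonempty = record
    { G-unique    = uniq σ
    ; G-nonempty  = nonempty
    ; G-bounded   = λ u∈ → ≤-trans (∈⇒≤maxS u∈) (m≤n+m _ _)
    ; F-bounded   = ∈⇒≤maxS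
    ; f-into      = proj₁ emb
    ; f-injective = φ-injective
    ; f-shadows   = point-◁
    }

  module _ {G F m f} (sh : Shadowing G F m f) where

    view-≤ : ∀ α {u} → u ∈ FS G → viewAlong α G u ≤ viewAlong α F (f u)
    view-≤ α {u} u∈ =
      length-≤-injection _≟_ f (Unique.filter⁺ (views? α G u) (G-unique sh))
        (λ a b → f-injective sh (proj₁ (∈-filter⁻ (views? α G u) a)) (proj₁ (∈-filter⁻ (views? α G u) b)))
        into
      where
      into : ∀ {w} → w ∈ filter (views? α G u) (FS G) → f w ∈ filter (views? α F (f u)) (FS F)
      into w∈ with ∈-filter⁻ (views? α G u) w∈
      ... | w∈G , w≢u , meet , meet' = ∈-filter⁺ (views? α F (f u)) (f-into sh w∈G)
        ( (λ fw≡fu → w≢u (f-injective sh w∈G u∈ fw≡fu))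
        , shadows-meet α (f-shadows sh u∈ α) (f-shadows sh w∈G α) meet
        , shadows-meet α (f-shadows sh w∈G α) (f-shadows sh u∈ α) meet')

    shadowing-wide : ∀ {d} → Wide d F → Wide d G
    shadowing-wide F-wide u∈ =
      ≤-<-trans (⊔-mono-≤ (view-≤ horizontal u∈) (view-≤ vertical u∈)) (F-wide (f-into sh u∈))

    shadowing-single : length (FS F) ≡ 1 → length (FS G) ≡ 1
    shadowing-single single = ≤-antisym
      (subst (_ ≤_) single (length-≤-injection _≟_ f (G-unique sh) (f-injective sh) (f-into sh)))
      (G-nonempty sh)

    f≢fresh : ∀ {k u} → m < k → u ∈ FS G → f u ≢ k
    f≢fresh m<k u∈ fu≡k = <-irrefl fu≡k (≤-<-trans (F-bounded sh (f-into sh u∈)) m<k)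

    AtMostOneHit : ℕ → ℕ → Set
    AtMostOneHit i j =
      ∀ {u v} → u ∈ FS G → v ∈ FS G → ¬ Misses i j (f u) → ¬ Misses i j (f v) → u ≡ v

    hits-only : ∀ {i j} t → (∀ {u} → u ∈ FS G → ¬ Misses i j (f u) → f u ≡ t) → AtMostOneHit i j
    hits-only t to-t u∈ v∈ hit-u hit-v =
      f-injective sh u∈ v∈ (trans (to-t u∈ hit-u) (sym (to-t v∈ hit-v)))

    missing-i : ∀ {i j} → ¬ Any.Any (λ u → f u ≡ i) (FS G) → AtMostOneHit i j
    missing-i {i} {j} no-i = hits-only j λ u∈ hit → case-hit u∈ (¬misses⇒hits hit)
      where
      case-hit : ∀ {u} → u ∈ FS G → f u ≡ i ⊎ f u ≡ j → f u ≡ j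
      case-hit u∈ (inj₁ fu≡i) = ⊥-elim (no-i (lose u∈ fu≡i))
      case-hit u∈ (inj₂ fu≡j) = fu≡j

    missing-j : ∀ {i j} → ¬ Any.Any (λ u → f u ≡ j) (FS G) → AtMostOneHit i j
    missing-j {i} {j} no-j = hits-only i λ u∈ hit → case-hit u∈ (¬misses⇒hits hit)
      where
      case-hit : ∀ {u} → u ∈ FS G → f u ≡ i ⊎ f u ≡ j → f u ≡ i
      case-hit u∈ (inj₁ fu≡i) = fu≡i
      case-hit u∈ (inj₂ fu≡j) = ⊥-elim (no-j (lose u∈ fu≡j))

    -- π merges i and j but not both have a preimage: σ does nothing and the
    -- assignment follows the redirection of π's indices.
    skip-step : ∀ {i j k} → m < k → AtMostOneHit i j →
                Shadowing G (merge F i j k) k (redirect i j k ∘ f)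
    skip-step {i} {j} {k} m<k one-hit = record
      { G-unique    = G-unique sh
      ; G-nonempty  = G-nonempty sh
      ; G-bounded   = λ u∈ → ≤-trans (G-bounded sh u∈) (+-monoˡ-≤ offset (<⇒≤ m<k))
      ; F-bounded   = merge-bounded F i j (F-bounded sh) m<k
      ; f-into      = λ u∈ → redirect-∈ F i j k (f-into sh u∈)
      ; f-injective = injective
      ; f-shadows   = λ u∈ → ◁-widen (f-shadows sh u∈) (redirect-⊑ᴿ F i j k (f≢fresh m<k u∈))
      }
      where
      injective : ∀ {u v} → u ∈ FS G → v ∈ FS G →
                  redirect i j k (f u) ≡ redirect i j k (f v) → u ≡ v
      injective {u} {v} u∈ v∈ eq with u ≟ v
      ... | yes u≡v = u≡v
      ... | no u≢v =
        let hit-u , hit-v = redirect-collision (λ fu≡fv → u≢v (f-injective sh u∈ v∈ fu≡fv))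
                              (f≢fresh m<k u∈) (f≢fresh m<k v∈) eq
        in one-hit u∈ v∈ hit-u hit-v

    -- π merges f u and f v: σ merges u and v into the fresh index k + offset,
    -- which is assigned to k; shadowing of the merged rectangles follows from ◁-hull.
    merge-step : ∀ {k u v} → m < k → u ∈ FS G → v ∈ FS G →
      Shadowing (merge G u v (k + offset)) (merge F (f u) (f v) k) k (assign (k + offset) k f)
    merge-step {k} {u} {v} m<k u∈ v∈ = record
      { G-unique    = merge-unique G u v (G-unique sh) below-k'
      ; G-nonempty  = s≤s z≤n
      ; G-bounded   = merge-bounded G u v (G-bounded sh) (+-monoˡ-< offset m<k)
      ; F-bounded   = merge-bounded F (f u) (f v) (F-bounded sh) m<k
      ; f-into      = into
      ; f-injective = assign-injective (λ w∈ → fresh (proj₁ (survivor w∈)))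
                        (λ w∈ → f≢fresh m<k (proj₁ (survivor w∈)))
                        (λ w∈ w'∈ → f-injective sh (proj₁ (survivor w∈)) (proj₁ (survivor w'∈)))
      ; f-shadows   = shadows
      }
      where
      k' : ℕ
      k' = k + offset
      below-k' : ∀ {w} → w ∈ FS G → w < k'
      below-k' w∈ = ≤-<-trans (G-bounded sh w∈) (+-monoˡ-< offset m<k)
      fresh : ∀ {w} → w ∈ FS G → w ≢ k'
      fresh w∈ w≡k' = <-irrefl w≡k' (below-k' w∈)
      survivor : ∀ {w} → w ∈ filter (misses? u v) (FS G) → w ∈ FS G × Misses (f u) (f v) (f w)
      survivor w∈ with ∈-filter⁻ (misses? u v) w∈
      ... | w∈G , w≢u , w≢v =
        w∈G , (λ fw≡fu → w≢u (f-injective sh w∈G u∈ fw≡fu))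
            , (λ fw≡fv → w≢v (f-injective sh w∈G v∈ fw≡fv))
      into : ∀ {w} → w ∈ FS (merge G u v k') → assign k' k f w ∈ FS (merge F (f u) (f v) k)
      into (here refl) rewrite assign-new k' k f = here refl
      into (there w∈) with survivor w∈
      ... | w∈G , miss rewrite assign-old {k'} {k} {f} (fresh w∈G) =
        there (∈-filter⁺ (misses? (f u) (f v)) (f-into sh w∈G) miss)
      shadows : ∀ {w} → w ∈ FS (merge G u v k') →
                FR (merge G u v k') w ◁ FR (merge F (f u) (f v) k) (assign k' k f w)
      shadows (here refl) rewrite assign-new k' k f | merge-new G u v k' | merge-new F (f u) (f v) k =
        ◁-hull (f-shadows sh u∈) (f-shadows sh v∈)
      shadows {w} (there w∈) with survivor w∈
      ... | w∈G , _ rewrite assign-old {k'} {k} {f} (fresh w∈G) | merge-old G u v (fresh w∈G)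
                          | merge-old F (f u) (f v) (f≢fresh m<k w∈G) =
        f-shadows sh w∈G

  -- When σ takes no step it may start its
  -- remaining decomposition from an earlier index (lower-start).
  replay : ∀ {d F m G f} → WideDecompFrom d F m → Shadowing G F m f → WideDecompFrom d G (m + offset)
  replay (done F-wide single) sh = done (shadowing-wide sh F-wide) (shadowing-single sh single)
  replay {G = G} {f} (step i j k i∈ j∈ i≢j m<k F-wide rest) sh
    with any? (λ u → f u ≟ i) (FS G) | any? (λ v → f v ≟ j) (FS G)
  ... | yes hit-i | yes hit-j with find hit-i | find hit-j
  ...   | u , u∈ , refl | v , v∈ , refl =
    step u v (k + offset) u∈ v∈ (λ u≡v → i≢j (cong f u≡v)) (+-monoˡ-< offset m<k)
      (shadowing-wide sh F-wide) (replay rest (merge-step sh m<k u∈ v∈))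
  replay (step i j k i∈ j∈ i≢j m<k F-wide rest) sh | no no-i | _ =
    lower-start (+-monoˡ-≤ offset (<⇒≤ m<k)) (replay rest (skip-step sh m<k (missing-i sh no-i)))
  replay (step i j k i∈ j∈ i≢j m<k F-wide rest) sh | yes _ | no no-j =
    lower-start (+-monoˡ-≤ offset (<⇒≤ m<k)) (replay rest (skip-step sh m<k (missing-j sh no-j)))

subpattern-decomposable : ∀ {σ π d} → Subpattern σ π → 1 ≤ length (S σ) →
                          HasWideDecomp d π → HasWideDecomp d σ
subpattern-decomposable {σ} {π} (embeds φ emb) nonempty π-decomp =
  lower-start (m≤n+m _ _) (replay π-decomp (initial nonempty))
  where open Replay σ π φ emb

lemma1 : (σ π : Perm) → Subpattern σ π → (a b : ℕ) → IsWidth σ a → IsWidth π b → a ≤ b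
lemma1 σ π sub a b (σ-decomp , a-minimal) (π-decomp , _) =
  a-minimal b (subpattern-decomposable sub (decomposable⇒nonempty σ-decomp) π-decomp)
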